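{- Let $\mathcal{D}$ be a finite set of formulas closed under subformulas and single negation. Let $G=\langle W,R,S,\nu\rangle$ be a quasi-frame satisfying $(*)$: whenever $xRy$, there is a formula $A\in(\nu(y)\setminus\nu(x))\cap\{\Box D\mid D\in\mathcal{D}\}$. Then $(*)$ also holds on the $\mathbf{IL}$-closure of $G$, i.e. on the minimal adequate labeled $\mathbf{IL}$-frame $\langle W,R',S',\nu\rangle$ with $R\subseteq R'$ and $S\subseteq S'$.
   Context: Fix a logic $\mathbf{IL X}$ (the basic interpretability logic $\mathbf{IL}$ extended by axiom schemata); "maximal consistent set" means maximal $\mathbf{IL X}$-consistent set. The single negation ${\sim}A$ is $B$ if $A=\neg B$, else $\neg A$. For maximal consistent sets: $\Gamma\prec\Delta$ iff $\Box A\in\Gamma$ implies $A,\Box A\in\Delta$; $\Gamma\prec_C\Delta$ iff $A\rhd C\in\Gamma$ implies $\neg A,\Box\neg A\in\Delta$. A labeling $\nu$ assigns to every world a maximal consistent set and to some $R$-related pairs $\langle x,y\rangle$ a formula $\nu(x,y)$. The $C$-critical cone $\mathcal{C}^C_x$ is the smallest set containing all $y$ with $\nu(x,y)=C$ and closed under $S_x$ and $R$; the generalized cone $\mathcal{G}^C_x$ is the smallest set containing $\mathcal{C}^C_x$ closed under $R$ and all $S_w$. A quasi-frame is $\langle W,R,S,\nu\rangle$, $S=\{S_x\}_{x\in W}$, with: $R$ conversely well-founded; $yS_xz\rightarrow xRy\wedge xRz$; $xRy\rightarrow\nu(x)\prec\nu(y)$; $A\neq B\rightarrow\mathcal{G}^A_x\cap\mathcal{G}^B_x=\varnothing$;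 $y\in\mathcal{C}^A_x\rightarrow\nu(x)\prec_A\nu(y)$. An adequate labeled $\mathbf{IL}$-frame is a quasi-frame that is moreover an $\mathbf{IL}$-frame: $R$ transitive, $xRy\rightarrow yS_xy$, $xRyRz\rightarrow yS_xz$, each $S_x$ transitive. Such a minimal extension exists (every quasi-frame has an adequate labeled $\mathbf{IL}$-frame extension on the same domain and labeling). -}

module Defs where

open import Data.Nat using (ℕ)
open import Data.List using (List; []; _∷_; foldr)
open import Data.List.Membership.Propositional using (_∈_)
open import Data.List.Relation.Unary.All using (All)
open import Data.Maybe using (Maybe; just)
open import Data.Product using (Σ; _×_; _,_)
open import Data.Empty using (⊥)
open import Relation.Nullary using (¬_)
open import Relation.Binary.PropositionalEquality using (_≡_; _≢_)
open import Induction.WellFounded using (WellFounded)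
open import Level using () renaming (suc to lsuc; zero to lzero)

infixr 6 _⇒_
infix 7 _▷_
infix 8 □_ ¬ᶠ_ ◇_ ~_
infixr 5 _∨ᶠ_
infixr 5 _∧ᶠ_

data Fm : Set where
  var : ℕ → Fm
  ⊥ᶠ  : Fm
  _⇒_ : Fm → Fm → Fm
  □_  : Fm → Fm
  _▷_ : Fm → Fm → Fm

¬ᶠ_ : Fm → Fm
¬ᶠ A = A ⇒ ⊥ᶠ

_∨ᶠ_ : Fm → Fm → Fm
A ∨ᶠ B = ¬ᶠ A ⇒ B

_∧ᶠ_ : Fm → Fm → Fm
A ∧ᶠ B = ¬ᶠ (A ⇒ ¬ᶠ B)

◇_ : Fm → Fm
◇ A = ¬ᶠ □ ¬ᶠ A

~_ : Fm → Fm
~ (A ⇒ ⊥ᶠ) = A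
~ A = ¬ᶠ A

data ImmSub : Fm → Fm → Set where
  ⇒l : ∀ {A B} → ImmSub A (A ⇒ B)
  ⇒r : ∀ {A B} → ImmSub B (A ⇒ B)
  □s : ∀ {A} → ImmSub A (□ A)
  ▷l : ∀ {A B} → ImmSub A (A ▷ B)
  ▷r : ∀ {A B} → ImmSub B (A ▷ B)

SubClosed : List Fm → Set
SubClosed 𝒟 = ∀ {A B} → ImmSub B A → A ∈ 𝒟 → B ∈ 𝒟

NegClosed : List Fm → Set
NegClosed 𝒟 = ∀ {A} → A ∈ 𝒟 → (~ A) ∈ 𝒟

data _⊢_ (X : Fm → Set) : Fm → Set where
  axX : ∀ {A} → X A → X ⊢ A
  P1  : ∀ {A B} → X ⊢ (A ⇒ B ⇒ A)
  P2  : ∀ {A B C} → X ⊢ ((A ⇒ B ⇒ C) ⇒ (A ⇒ B) ⇒ A ⇒ C)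
  P3  : ∀ {A} → X ⊢ (¬ᶠ ¬ᶠ A ⇒ A)
  K   : ∀ {A B} → X ⊢ (□ (A ⇒ B) ⇒ □ A ⇒ □ B)
  L   : ∀ {A} → X ⊢ (□ (□ A ⇒ A) ⇒ □ A)
  J1  : ∀ {A B} → X ⊢ (□ (A ⇒ B) ⇒ A ▷ B)
  J2  : ∀ {A B C} → X ⊢ (((A ▷ B) ∧ᶠ (B ▷ C)) ⇒ (A ▷ C))
  J3  : ∀ {A B C} → X ⊢ (((A ▷ C) ∧ᶠ (B ▷ C)) ⇒ ((A ∨ᶠ B) ▷ C))
  J4  : ∀ {A B} → X ⊢ (A ▷ B ⇒ ◇ A ⇒ ◇ B)
  J5  : ∀ {A} → X ⊢ (◇ A ▷ A)
  MP  : ∀ {A B} → X ⊢ (A ⇒ B) → X ⊢ A → X ⊢ B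
  Nec : ∀ {A} → X ⊢ A → X ⊢ (□ A)

FmSet : Set₁
FmSet = Fm → Set

_⊆ᶠ_ : FmSet → FmSet → Set
Γ ⊆ᶠ Δ = ∀ A → Γ A → Δ A

Consistent : (X : Fm → Set) → FmSet → Set
Consistent X Γ = ¬ (Σ (List Fm) λ As → All Γ As × (X ⊢ foldr _⇒_ ⊥ᶠ As))

MCS : (X : Fm → Set) → FmSet → Set₁
MCS X Γ = Consistent X Γ × (∀ Δ → Γ ⊆ᶠ Δ → Consistent X Δ → Δ ⊆ᶠ Γ)

_≺_ : FmSet → FmSet → Set
Γ ≺ Δ = ∀ A → Γ (□ A) → Δ A × Δ (□ A)

_≺[_]_ : FmSet → Fm → FmSet → Set
Γ ≺[ C ] Δ = ∀ A → Γ (A ▷ C) → Δ (¬ᶠ A) × Δ (□ ¬ᶠ A)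

-- Labeled frames.  W worlds, R accessibility, S x y z means  y S_x z,
-- ν labels worlds with sets of formulas, lab labels (some) pairs.

module _ {W : Set} (R : W → W → Set) (S : W → W → W → Set)
         (lab : W → W → Maybe Fm) where

  data Cone (C : Fm) (x : W) : W → Set where
    base : ∀ {y} → lab x y ≡ just C → Cone C x y
    viaS : ∀ {y z} → Cone C x y → S x y z → Cone C x z
    viaR : ∀ {y z} → Cone C x y → R y z → Cone C x z

  data GCone (C : Fm) (x : W) : W → Set where
    base : ∀ {y} → Cone C x y → GCone C x y
    viaR : ∀ {y z} → GCone C x y → R y z → GCone C x z
    viaS : ∀ {w y z} → GCone C x y → S w y z → GCone C x z

record QuasiFrame (X : Fm → Set) (W : Set) (R : W → W → Set)
                  (S : W → W → W → Set) (ν : W → FmSet)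
                  (lab : W → W → Maybe Fm) : Set₁ where
  field
    ν-mcs    : ∀ w → MCS X (ν w)
    lab-R    : ∀ {x y C} → lab x y ≡ just C → R x y
    conv-wf  : WellFounded (λ y x → R x y)
    S-R      : ∀ {x y z} → S x y z → R x y × R x z
    R-≺      : ∀ {x y} → R x y → ν x ≺ ν y
    gdisj    : ∀ {A B x y} → A ≢ B → GCone R S lab A x y → GCone R S lab B x y → ⊥
    cone-≺   : ∀ {A x y} → Cone R S lab A x y → ν x ≺[ A ] ν y

record ILFrame (W : Set) (R : W → W → Set) (S : W → W → W → Set) : Set where
  field
    R-trans  : ∀ {x y z} → R x y → R y z → R x z
    S-refl   : ∀ {x y} → R x y → S x y y
    R⊆S      : ∀ {x y z} → R x y → R y z → S x y z
    S-trans  : ∀ {x y z u} → S x y z → S x z u → S x y u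

Adequate : (X : Fm → Set) (W : Set) (R : W → W → Set)
           (S : W → W → W → Set) (ν : W → FmSet)
           (lab : W → W → Maybe Fm) → Set₁
Adequate X W R S ν lab = QuasiFrame X W R S ν lab × ILFrame W R S

IsILClosure : (X : Fm → Set) (W : Set) (R : W → W → Set)
              (S : W → W → W → Set) (ν : W → FmSet)
              (lab : W → W → Maybe Fm)
              (R' : W → W → Set) (S' : W → W → W → Set) → Set₁
IsILClosure X W R S ν lab R' S' =
  Adequate X W R' S' ν lab
  × (∀ {x y} → R x y → R' x y)
  × (∀ {x y z} → S x y z → S' x y z)
  × (∀ (R'' : W → W → Set) (S'' : W → W → W → Set)
     → Adequate X W R'' S'' ν lab
     → (∀ {x y} → R x y → R'' x y)
     → (∀ {x y z} → S x y z → S'' x y z)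
     → (∀ {x y} → R' x y → R'' x y) × (∀ {x y z} → S' x y z → S'' x y z))

Star : (𝒟 : List Fm) {W : Set} (R : W → W → Set) (ν : W → FmSet) → Set
Star 𝒟 R ν = ∀ {x y} → R x y → Σ Fm λ D → D ∈ 𝒟 × ν y (□ D) × ¬ ν x (□ D)

-- The IL-closure adds no R-edges outside the transitive closure R⁺: cutting an
-- adequate labeled IL-frame down to R⁺ (and S down to S-triples whose legs lie in
-- R⁺) leaves an adequate labeled IL-frame that still contains R and S, so by
-- minimality R' ⊆ R⁺. Condition (*) lifts from R to R⁺: for a chain
-- x R x₁ R … R y take the witness □D of the first step; it is absent from ν x, and
-- it survives to ν y because ν a ≺ ν b keeps every boxed formula of ν a.
module Submission where

open import Defs
open import Data.List using (List)
open import Data.Maybe using (Maybe; just)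
open import Data.Product using (_×_; _,_; proj₁; proj₂)
open import Relation.Binary.PropositionalEquality using (_≡_)
open import Relation.Binary.Definitions using (Transitive)
open import Relation.Binary.Construct.Closure.Transitive using (TransClosure; [_]; _∷_; _++_)
open import Relation.Binary.Construct.Intersection using (_∩_)
open import Induction.WellFounded using (module Subrelation)

private
  variable
    W : Set

_∩ˢ_ : (W → W → W → Set) → (W → W → Set) → W → W → W → Set
(S ∩ˢ T) x y z = S x y z × T x y × T x z

module _ {R₁ R₂ : W → W → Set} {S₁ S₂ : W → W → W → Set} {lab : W → W → Maybe Fm}
         (R₁⊆R₂ : ∀ {x y} → R₁ x y → R₂ x y)
         (S₁⊆S₂ : ∀ {x y z} → S₁ x y z → S₂ x y z) where

  Cone-mono : ∀ {C x y} → Cone R₁ S₁ lab C x y → Cone R₂ S₂ lab C x y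
  Cone-mono (base e)   = base e
  Cone-mono (viaS c s) = viaS (Cone-mono c) (S₁⊆S₂ s)
  Cone-mono (viaR c r) = viaR (Cone-mono c) (R₁⊆R₂ r)

  GCone-mono : ∀ {C x y} → GCone R₁ S₁ lab C x y → GCone R₂ S₂ lab C x y
  GCone-mono (base c)   = base (Cone-mono c)
  GCone-mono (viaR g r) = viaR (GCone-mono g) (R₁⊆R₂ r)
  GCone-mono (viaS g s) = viaS (GCone-mono g) (S₁⊆S₂ s)

  QuasiFrame-restrict : ∀ {X ν} → QuasiFrame X W R₂ S₂ ν lab
    → (∀ {x y C} → lab x y ≡ just C → R₁ x y)
    → (∀ {x y z} → S₁ x y z → R₁ x y × R₁ x z)
    → QuasiFrame X W R₁ S₁ ν lab
  QuasiFrame-restrict qf lab-R₁ S₁-R₁ = record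
    { ν-mcs   = ν-mcs
    ; lab-R   = lab-R₁
    ; conv-wf = Subrelation.wellFounded R₁⊆R₂ conv-wf
    ; S-R     = S₁-R₁
    ; R-≺     = λ r → R-≺ (R₁⊆R₂ r)
    ; gdisj   = λ A≢B g h → gdisj A≢B (GCone-mono g) (GCone-mono h)
    ; cone-≺  = λ c → cone-≺ (Cone-mono c)
    }
    where open QuasiFrame qf

ILFrame-∩ : {R : W → W → Set} {S : W → W → W → Set} {T : W → W → Set}
  → ILFrame W R S → Transitive T → ILFrame W (R ∩ T) (S ∩ˢ T)
ILFrame-∩ il T-trans = record
  { R-trans = λ (r , t) (r′ , t′) → R-trans r r′ , T-trans t t′
  ; S-refl  = λ (r , t) → S-refl r , t , t
  ; R⊆S     = λ (r , t) (r′ , t′) → R⊆S r r′ , t , T-trans t t′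
  ; S-trans = λ (s , t , _) (s′ , _ , t′) → S-trans s s′ , t , t′
  }
  where open ILFrame il

ILClosure⊆TransClosure : ∀ {X R S ν lab R' S'} → QuasiFrame X W R S ν lab
  → IsILClosure X W R S ν lab R' S'
  → ∀ {x y} → R' x y → TransClosure R x y
ILClosure⊆TransClosure {W} {X} {R} {S} {ν} {lab} {R'} {S'} qf ((qf' , il') , R⊆R' , S⊆S' , least) r' =
  proj₂ (proj₁ (least (R' ∩ R⁺) (S' ∩ˢ R⁺) (qf⁺ , il⁺) R⊆R'∩R⁺ S⊆S'∩ˢR⁺) r')
  where
  R⁺ : W → W → Set
  R⁺ = TransClosure R
  open QuasiFrame qf using (lab-R; S-R)

  R⊆R'∩R⁺ : ∀ {x y} → R x y → (R' ∩ R⁺) x y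
  R⊆R'∩R⁺ r = R⊆R' r , [ r ]

  S⊆S'∩ˢR⁺ : ∀ {x y z} → S x y z → (S' ∩ˢ R⁺) x y z
  S⊆S'∩ˢR⁺ s = S⊆S' s , [ proj₁ (S-R s) ] , [ proj₂ (S-R s) ]

  qf⁺ : QuasiFrame X W (R' ∩ R⁺) (S' ∩ˢ R⁺) ν lab
  qf⁺ = QuasiFrame-restrict proj₁ proj₁ qf'
    (λ e → QuasiFrame.lab-R qf' e , [ lab-R e ])
    (λ (s , t , t′) → (proj₁ (QuasiFrame.S-R qf' s) , t) , (proj₂ (QuasiFrame.S-R qf' s) , t′))

  il⁺ : ILFrame W (R' ∩ R⁺) (S' ∩ˢ R⁺)
  il⁺ = ILFrame-∩ il' _++_

module _ {R : W → W → Set} {ν : W → FmSet} (R-≺ : ∀ {x y} → R x y → ν x ≺ ν y) where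

  □-persistent⁺ : ∀ {x y} → TransClosure R x y → ∀ A → ν x (□ A) → ν y (□ A)
  □-persistent⁺ [ r ]    A □A = proj₂ (R-≺ r A □A)
  □-persistent⁺ (r ∷ r⁺) A □A = □-persistent⁺ r⁺ A (proj₂ (R-≺ r A □A))

  Star-TransClosure : ∀ {𝒟} → Star 𝒟 R ν → Star 𝒟 (TransClosure R) ν
  Star-TransClosure star [ r ]    = star r
  Star-TransClosure star (r ∷ r⁺) with star r
  ... | D , D∈𝒟 , □D , ¬□D = D , D∈𝒟 , □-persistent⁺ r⁺ D □D , ¬□D

Star-mono : ∀ {𝒟} {R₁ R₂ : W → W → Set} {ν : W → FmSet}
  → (∀ {x y} → R₁ x y → R₂ x y) → Star 𝒟 R₂ ν → Star 𝒟 R₁ ν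
Star-mono R₁⊆R₂ star r = star (R₁⊆R₂ r)

corollary5p3 : (X : Fm → Set) (𝒟 : List Fm) → SubClosed 𝒟 → NegClosed 𝒟
    → (W : Set) (R : W → W → Set) (S : W → W → W → Set)
      (ν : W → FmSet) (lab : W → W → Maybe Fm)
    → QuasiFrame X W R S ν lab
    → Star 𝒟 R ν
    → (R' : W → W → Set) (S' : W → W → W → Set)
    → IsILClosure X W R S ν lab R' S'
    → Star 𝒟 R' ν
corollary5p3 X 𝒟 _ _ W R S ν lab qf star R' S' closure =
  Star-mono {R₂ = TransClosure R} {ν} (ILClosure⊆TransClosure qf closure)
    (Star-TransClosure (QuasiFrame.R-≺ qf) star)
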